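{- The logic $L$ is sound with respect to the class of all PN-models: every theorem of $L$ is forced at every world of every PN-model.
   Context: Formulas are built from a fixed denumerable set $PV$ of propositional variables and the constant $\bot$ using $\land, \lor, \rightarrow$ and the unary operator $\Box$ ($\lnot\varphi$ abbreviates $\varphi \rightarrow \bot$). The logic $L$ is the smallest set of formulas containing all instances (in this modal language) of the axiom schemes of intuitionistic propositional logic and all instances of the scheme $\Box \varphi \rightarrow \varphi$, and closed under modus ponens (from $\varphi$ and $\varphi \rightarrow \psi$ infer $\psi$) and the extensionality rule (from $\varphi \leftrightarrow \psi$ infer $\Box \varphi \leftrightarrow \Box \psi$). A PN-frame is a triple $\langle W, \mathcal{N}, \leq \rangle$ where $\leq$ is a partial order on $W$ and $\mathcal{N}: W \to P(P(W))$ satisfies: whenever $w \leq v$, $v \in X \subseteq W$ and $X \in \mathcal{N}_w$, then $X \in \mathcal{N}_v$. A PN-model adds a valuation $V: PV \to P(W)$ with $w \in V(q)$, $w \leq v$ implying $v \in V(q)$. Forcing: $w \nVdash \bot$; $w \Vdash q$ iff $w \in V(q)$; $\lor, \land$ pointwise; $w \Vdash \varphi \rightarrow \psi$ iff for every $v \geq w$, $v \nVdash \varphi$ or $v \Vdash \psi$; $w \Vdash \Box \varphi$ iff $w \Vdash \varphi$ and $\{z \in W : z \Vdash \varphi\} \in \mathcal{N}_w$. -}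

module Defs where

open import Data.Nat using (ℕ)
open import Data.Product using (_×_; _,_)
open import Data.Sum using (_⊎_)
open import Data.Empty using (⊥)
open import Relation.Binary.PropositionalEquality using (_≡_)
open import Relation.Binary.Structures using (IsPartialOrder)

infixr 6 _∧'_
infixr 5 _∨'_
infixr 4 _⇒_

data Fm : Set where
  var  : ℕ → Fm
  ⊥'   : Fm
  _∧'_ : Fm → Fm → Fm
  _∨'_ : Fm → Fm → Fm
  _⇒_  : Fm → Fm → Fm
  □    : Fm → Fm

¬' : Fm → Fm
¬' φ = φ ⇒ ⊥'

_⇔_ : Fm → Fm → Fm
φ ⇔ ψ = (φ ⇒ ψ) ∧' (ψ ⇒ φ)

data L : Fm → Set where
  ax-K   : ∀ φ ψ → L (φ ⇒ ψ ⇒ φ)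
  ax-S   : ∀ φ ψ χ → L ((φ ⇒ ψ ⇒ χ) ⇒ (φ ⇒ ψ) ⇒ φ ⇒ χ)
  ax-∧₁  : ∀ φ ψ → L (φ ∧' ψ ⇒ φ)
  ax-∧₂  : ∀ φ ψ → L (φ ∧' ψ ⇒ ψ)
  ax-∧I  : ∀ φ ψ → L (φ ⇒ ψ ⇒ φ ∧' ψ)
  ax-∨₁  : ∀ φ ψ → L (φ ⇒ φ ∨' ψ)
  ax-∨₂  : ∀ φ ψ → L (ψ ⇒ φ ∨' ψ)
  ax-∨E  : ∀ φ ψ χ → L ((φ ⇒ χ) ⇒ (ψ ⇒ χ) ⇒ φ ∨' ψ ⇒ χ)
  ax-⊥   : ∀ φ → L (⊥' ⇒ φ)
  ax-T   : ∀ φ → L (□ φ ⇒ φ)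
  mp     : ∀ {φ ψ} → L φ → L (φ ⇒ ψ) → L ψ
  ext    : ∀ {φ ψ} → L (φ ⇔ ψ) → L (□ φ ⇔ □ ψ)

-- Subsets of W are predicates W → Set; two subsets are equal iff they have
-- the same members.
_≐_ : {W : Set} → (W → Set) → (W → Set) → Set
_≐_ {W} X Y = ∀ (x : W) → (X x → Y x) × (Y x → X x)

-- PN-frames.  Since subsets are represented as predicates, N w must be a
-- family of *sets*, i.e. invariant under extensional equality of subsets.
record PNFrame : Set₁ where
  field
    W        : Set
    _≤_      : W → W → Set
    isPO     : IsPartialOrder _≡_ _≤_
    N        : W → (W → Set) → Set
    N-ext    : ∀ w X Y → X ≐ Y → N w X → N w Y
    N-mono   : ∀ w v (X : W → Set) → w ≤ v → X v → N w X → N v X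

record PNModel : Set₁ where
  field
    frame  : PNFrame
  open PNFrame frame public
  field
    V      : ℕ → W → Set
    V-mono : ∀ q w v → V q w → w ≤ v → V q v

module _ (M : PNModel) where
  open PNModel M

  _⊩_ : W → Fm → Set
  w ⊩ var q    = V q w
  w ⊩ ⊥'       = ⊥
  w ⊩ (φ ∧' ψ) = (w ⊩ φ) × (w ⊩ ψ)
  w ⊩ (φ ∨' ψ) = (w ⊩ φ) ⊎ (w ⊩ ψ)
  w ⊩ (φ ⇒ ψ)  = ∀ v → w ≤ v → v ⊩ φ → v ⊩ ψ
  w ⊩ □ φ      = (w ⊩ φ) × N w (λ z → z ⊩ φ)

  -- (w ⊩ (φ ⇒ ψ) unfolds "v ⊮ φ or v ⊩ ψ" intuitionistically as an implication.)

module Submission where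

open import Defs
open import Relation.Binary.PropositionalEquality using (_≡_)
open import Data.Product using (_,_; proj₁; proj₂)
open import Data.Sum using (inj₁; inj₂)
open import Relation.Binary.Structures using (IsPartialOrder; IsPreorder)

-- Forcing is persistent along ≤ (for □ this is exactly the condition on N),
-- so the intuitionistic axioms hold as in Kripke semantics and □φ → φ holds
-- because forcing □φ includes forcing φ.  For the extensionality rule, a
-- valid φ ⇔ ψ makes the truth sets of φ and ψ extensionally equal, and N
-- respects that equality.

module _ (M : PNModel) where
  open PNModel M

  private
    _⊨_ : W → Fm → Set
    _⊨_ = _⊩_ M

    ≤-refl : ∀ {w} → w ≤ w
    ≤-refl = IsPreorder.refl (IsPartialOrder.isPreorder isPO)

    ≤-trans : ∀ {u v w} → u ≤ v → v ≤ w → u ≤ w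
    ≤-trans = IsPreorder.trans (IsPartialOrder.isPreorder isPO)

  Valid : Fm → Set
  Valid φ = ∀ w → w ⊨ φ

  ⊩-mono : ∀ φ {w v} → w ≤ v → w ⊨ φ → v ⊨ φ
  ⊩-mono (var q)  w≤v h              = V-mono q _ _ h w≤v
  ⊩-mono ⊥'       w≤v ()
  ⊩-mono (φ ∧' ψ) w≤v (a , b)        = ⊩-mono φ w≤v a , ⊩-mono ψ w≤v b
  ⊩-mono (φ ∨' ψ) w≤v (inj₁ a)       = inj₁ (⊩-mono φ w≤v a)
  ⊩-mono (φ ∨' ψ) w≤v (inj₂ b)       = inj₂ (⊩-mono ψ w≤v b)
  ⊩-mono (φ ⇒ ψ)  w≤v h u v≤u        = h u (≤-trans w≤v v≤u)
  ⊩-mono (□ φ) {w} {v} w≤v (a , n)   = v⊩φ , N-mono w v _ w≤v v⊩φ n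
    where v⊩φ = ⊩-mono φ w≤v a

  ⊩-⇒-elim : ∀ φ ψ {w} → w ⊨ (φ ⇒ ψ) → w ⊨ φ → w ⊨ ψ
  ⊩-⇒-elim _ _ {w} h = h w ≤-refl

  valid-⇔⇒truthSets≐ : ∀ φ ψ → Valid (φ ⇔ ψ) → (_⊨ φ) ≐ (_⊨ ψ)
  valid-⇔⇒truthSets≐ φ ψ h x = ⊩-⇒-elim φ ψ (proj₁ (h x)) , ⊩-⇒-elim ψ φ (proj₂ (h x))

  ⊩-□-cong : ∀ φ ψ → (_⊨ φ) ≐ (_⊨ ψ) → ∀ w → w ⊨ □ φ → w ⊨ □ ψ
  ⊩-□-cong _ _ φ≐ψ w (a , n) = proj₁ (φ≐ψ w) a , N-ext w _ _ φ≐ψ n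

  ≐-sym : ∀ {X Y : W → _} → X ≐ Y → Y ≐ X
  ≐-sym X≐Y x = proj₂ (X≐Y x) , proj₁ (X≐Y x)

  sound : ∀ {φ} → L φ → Valid φ
  sound (ax-K φ ψ)    _ _ _ a u v≤u _ = ⊩-mono φ v≤u a
  sound (ax-S φ ψ χ)  _ _ _ f u v≤u g x u≤x a =
    f x (≤-trans v≤u u≤x) a x ≤-refl (g x u≤x a)
  sound (ax-∧₁ φ ψ)   _ _ _ (a , _) = a
  sound (ax-∧₂ φ ψ)   _ _ _ (_ , b) = b
  sound (ax-∧I φ ψ)   _ _ _ a u v≤u b = ⊩-mono φ v≤u a , b
  sound (ax-∨₁ φ ψ)   _ _ _ a = inj₁ a
  sound (ax-∨₂ φ ψ)   _ _ _ b = inj₂ b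
  sound (ax-∨E φ ψ χ) _ _ _ f u v≤u g x u≤x (inj₁ a) = f x (≤-trans v≤u u≤x) a
  sound (ax-∨E φ ψ χ) _ _ _ f u v≤u g x u≤x (inj₂ b) = g x u≤x b
  sound (ax-⊥ φ)      _ _ _ ()
  sound (ax-T φ)      _ _ _ (a , _) = a
  sound (mp {φ} {ψ} ⊢φ ⊢φ⇒ψ) w = ⊩-⇒-elim φ ψ (sound ⊢φ⇒ψ w) (sound ⊢φ w)
  sound (ext {φ} {ψ} ⊢φ⇔ψ) _ =
      (λ v _ → ⊩-□-cong φ ψ φ≐ψ v)
    , (λ v _ → ⊩-□-cong ψ φ (≐-sym φ≐ψ) v)
    where
      φ≐ψ : (_⊨ φ) ≐ (_⊨ ψ)
      φ≐ψ = valid-⇔⇒truthSets≐ φ ψ (sound ⊢φ⇔ψ)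

mainTheorem2 : ∀ (φ : Fm) → L φ → (M : PNModel) → (w : PNModel.W M) → _⊩_ M w φ
mainTheorem2 φ ⊢φ M = sound M ⊢φ
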